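{- Let $\mathcal{T}$ be an $\mathcal{EL}^{+}$ TBox in normal form, let $\mathcal{T}'\subseteq\mathcal{T}$, and let $C,D$ be concept names occurring in $\mathcal{T}$ (or $\top$). Let $\phi^{all}_{\mathcal{T}(po)}$ be the pinpointing Horn formula of $\mathcal{T}$ described in the context. Then $\mathcal{T}'$ is a MinA for $C\sqsubseteq D$ (i.e. $C\sqsubseteq_{\mathcal{T}'}D$ and $C\not\sqsubseteq_{\mathcal{T}''}D$ for every $\mathcal{T}''\subsetneq\mathcal{T}'$) if and only if the Horn propositional formula $$\phi^{all}_{\mathcal{T}(po)}\;\wedge\;\bigwedge_{ax_i\in\mathcal{T}'}s_{[ax_i]}\;\wedge\;\neg s_{[C\sqsubseteq D]}$$ is minimally unsatisfiable, in the sense that it is unsatisfiable, while for every $ax_j\in\mathcal{T}'$ the formula obtained by deleting the unit clause $s_{[ax_j]}$ (keeping all clauses of $\phi^{all}_{\mathcal{T}(po)}$ and the clause $\neg s_{[C\sqsubseteq D]}$) is satisfiable.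
   Context: $\mathcal{EL}^{+}$: concepts are built from concept names and $\top$ using conjunction $X\sqcap Y$ and existential restriction $\exists r.X$ ($r$ a role name); an interpretation $(\Delta^I,\cdot^I)$ maps concept names to subsets of $\Delta^I$ and role names to binary relations, with $\top^I=\Delta^I$, $(X\sqcap Y)^I=X^I\cap Y^I$, $(\exists r.X)^I=\{x\mid \exists y:(x,y)\in r^I, y\in X^I\}$. A TBox is a finite set of general concept inclusions $X\sqsubseteq Y$ (satisfied if $X^I\subseteq Y^I$) and role inclusions $r_1\circ\cdots\circ r_n\sqsubseteq s$ (satisfied if $r_1^I\circ\cdots\circ r_n^I\subseteq s^I$). $C\sqsubseteq_{\mathcal{T}}D$ means $C^I\subseteq D^I$ in every model $I$ of $\mathcal{T}$. Normal form: every GCI has one of the forms $C_1\sqcap\cdots\sqcap C_k\sqsubseteq D$ ($k\ge1$), $C\sqsubseteq\exists r.D$, $\exists r.C\sqsubseteq D$, with $C_i,C,D$ concept names or $\top$, and every RI is $r_1\circ\cdots\circ r_n\sqsubseteq s$ ($n\ge 1$). The classification algorithm derives assertions (GCIs of the form $C\sqsubseteq D$ or $C\sqsubseteq\exists r.D$ between concept names/$\top$ of $\mathcal{T}$), starting from the axioms of $\mathcal{T}$ and the trivial assertions $C\sqsubseteq C$, $C\sqsubseteq\top$, using the rules: (1) from $C\sqsubseteq C_1,\dots,C\sqsubseteq C_k$ and $C_1\sqcap\cdots\sqcap C_k\sqsubseteq D$ derive $C\sqsubseteq D$; (2) from $C\sqsubseteq C'$ and $C'\sqsubseteq\exists r.D$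 derive $C\sqsubseteq\exists r.D$; (3) from $C\sqsubseteq\exists r.E$, $E\sqsubseteq C'$ and $\exists r.C'\sqsubseteq D$ derive $C\sqsubseteq D$; (4) from $C_0\sqsubseteq\exists r_1.C_1,\dots,C_{n-1}\sqsubseteq\exists r_n.C_n$ and $r_1\circ\cdots\circ r_n\sqsubseteq s$ derive $C_0\sqsubseteq\exists s.C_n$. The formula $\phi^{all}_{\mathcal{T}(po)}$: introduce a Boolean selector variable $s_{[a]}$ for each axiom of $\mathcal{T}$ (GCI or RI) and each derived assertion $a$, where $s_{[a]}$ is the constant true for trivial assertions $C\sqsubseteq C$, $C\sqsubseteq\top$; for every application $r$ of a rule during classification (each distinct rule application considered once), with premises $\mathrm{antec}(r)$ and conclusion $a_i$, add the Horn clause $\big(\bigwedge_{a_j\in\mathrm{antec}(r)}s_{[a_j]}\big)\to s_{[a_i]}$. The variable $s_{[C\sqsubseteq D]}$ is the selector of the assertion $C\sqsubseteq D$. -}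

module Defs where

open import Data.Nat using (ℕ)
open import Data.Bool using (Bool; true)
open import Data.List using (List; []; _∷_)
open import Data.List.Membership.Propositional using (_∈_; _∉_)
open import Data.List.Relation.Binary.Subset.Propositional using (_⊆_)
open import Data.List.Relation.Unary.All using (All)
open import Data.Product using (Σ; ∃; ∃-syntax; _×_; _,_)
open import Data.Sum using (_⊎_)
open import Data.Unit using (⊤)
open import Data.Empty using (⊥)
open import Relation.Nullary using (¬_)
open import Relation.Binary.PropositionalEquality using (_≡_; _≢_)

CName : Set
CName = ℕ

RName : Set
RName = ℕ

data Bas : Set where
  top : Bas
  nm  : CName → Bas

-- Normal-form axioms (GCIs and RIs).
--   conj C₁ [C₂ … Cₖ] D   :  C₁ ⊓ C₂ ⊓ … ⊓ Cₖ ⊑ D     (k ≥ 1)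
--   exR C r D             :  C ⊑ ∃r.D
--   exL r C D             :  ∃r.C ⊑ D
--   ri r₁ [r₂ … rₙ] s     :  r₁ ∘ … ∘ rₙ ⊑ s          (n ≥ 1)
data NAx : Set where
  conj : Bas → List Bas → Bas → NAx
  exR  : Bas → RName → Bas → NAx
  exL  : RName → Bas → Bas → NAx
  ri   : RName → List RName → RName → NAx

sub : Bas → Bas → NAx
sub C D = conj C [] D

TBox : Set
TBox = List NAx

record Interp : Set₁ where
  field
    Δ    : Set
    conc : CName → Δ → Set
    role : RName → Δ → Δ → Set

module _ (I : Interp) where
  open Interp I

  ⟦_⟧ : Bas → Δ → Set
  ⟦ top ⟧  x = ⊤
  ⟦ nm A ⟧ x = conc A x

  Chain : List RName → Δ → Δ → Set
  Chain []       x y = x ≡ y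
  Chain (r ∷ rs) x y = ∃[ z ] (role r x z × Chain rs z y)

  SatAx : NAx → Set
  SatAx (conj C Cs D) = ∀ x → ⟦ C ⟧ x → All (λ E → ⟦ E ⟧ x) Cs → ⟦ D ⟧ x
  SatAx (exR C r D)   = ∀ x → ⟦ C ⟧ x → ∃[ y ] (role r x y × ⟦ D ⟧ y)
  SatAx (exL r C D)   = ∀ x y → role r x y → ⟦ C ⟧ y → ⟦ D ⟧ x
  SatAx (ri r rs s)   = ∀ x y → Chain (r ∷ rs) x y → role s x y

  Model : TBox → Set
  Model T = ∀ ax → ax ∈ T → SatAx ax

_⊨_⊑_ : TBox → Bas → Bas → Set₁
T ⊨ C ⊑ D = ∀ (I : Interp) → Model I T → ∀ x → ⟦ I ⟧ C x → ⟦ I ⟧ D x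

IsMinA : TBox → Bas → Bas → Set₁
IsMinA T' C D =
  (T' ⊨ C ⊑ D) ×
  (∀ (T'' : TBox) → T'' ⊆ T' → (∃[ ax ] (ax ∈ T' × ax ∉ T'')) → ¬ (T'' ⊨ C ⊑ D))

OccIn : Bas → NAx → Set
OccIn E (conj C Cs D) = E ≡ C ⊎ E ∈ Cs ⊎ E ≡ D
OccIn E (exR C r D)   = E ≡ C ⊎ E ≡ D
OccIn E (exL r C D)   = E ≡ C ⊎ E ≡ D
OccIn E (ri r rs s)   = ⊥

InSig : TBox → Bas → Set
InSig T E = E ≡ top ⊎ ∃[ ax ] (ax ∈ T × OccIn E ax)

Trivial : TBox → NAx → Set
Trivial T a = ∃[ C ] (InSig T C × (a ≡ sub C C ⊎ a ≡ sub C top))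

chainPrems : Bas → List (RName × Bas) → List NAx
chainPrems C []             = []
chainPrems C ((r , E) ∷ xs) = exR C r E ∷ chainPrems E xs

chainEnd : Bas → List (RName × Bas) → Bas
chainEnd C []             = C
chainEnd C ((r , E) ∷ xs) = chainEnd E xs

roles : List (RName × Bas) → List RName
roles []             = []
roles ((r , E) ∷ xs) = r ∷ roles xs

mapSub : Bas → List Bas → List NAx
mapSub C []       = []
mapSub C (E ∷ Es) = sub C E ∷ mapSub C Es

data RuleApp (T : TBox) : List NAx → NAx → Set where
  r1 : ∀ C C₁ Cs D → conj C₁ Cs D ∈ T →
       RuleApp T (conj C₁ Cs D ∷ sub C C₁ ∷ mapSub C Cs) (sub C D)
  r2 : ∀ C C' r D → exR C' r D ∈ T →
       RuleApp T (sub C C' ∷ exR C' r D ∷ []) (exR C r D)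
  r3 : ∀ C r E C' D → exL r C' D ∈ T →
       RuleApp T (exR C r E ∷ sub E C' ∷ exL r C' D ∷ []) (sub C D)
  r4 : ∀ C₀ r rs s (xs : List (RName × Bas)) → ri r rs s ∈ T →
       roles xs ≡ r ∷ rs →
       RuleApp T (ri r rs s ∷ chainPrems C₀ xs) (exR C₀ s (chainEnd C₀ xs))

data Derived (T : TBox) : NAx → Set where
  axm  : ∀ {a} → a ∈ T → Derived T a
  triv : ∀ {a} → Trivial T a → Derived T a
  rule : ∀ {ps a} → RuleApp T ps a → All (Derived T) ps → Derived T a

-- Clauses of φ^all_T(po): one Horn clause (⋀ ps) → c for each rule
-- application performed during classification.
Clause : TBox → List NAx → NAx → Set
Clause T ps c = RuleApp T ps c × All (Derived T) ps

-- Propositional semantics.  Variables s_[a] are indexed by a : NAx;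
-- an assignment is v : NAx → Bool; s_[a] is the constant true for
-- trivial assertions.

Sel : TBox → (NAx → Bool) → NAx → Set
Sel T v a = Trivial T a ⊎ v a ≡ true

SatPhiAll : TBox → (NAx → Bool) → Set
SatPhiAll T v = ∀ ps c → Clause T ps c → All (Sel T v) ps → Sel T v c

-- Satisfiability of  φ^all_T(po) ∧ ⋀_{ax ∈ U} s_[ax] ∧ ¬ s_[C ⊑ D],
-- the unit clauses being given by a predicate U on axioms.
Satisfiable : TBox → (NAx → Set) → Bas → Bas → Set
Satisfiable T U C D =
  ∃[ v ] (SatPhiAll T v × (∀ ax → U ax → Sel T v ax) × ¬ Sel T v (sub C D))

MinUnsat : TBox → TBox → Bas → Bas → Set
MinUnsat T T' C D =
  ¬ Satisfiable T (λ ax → ax ∈ T') C D ×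
  (∀ axj → axj ∈ T' → Satisfiable T (λ ax → ax ∈ T' × ax ≢ axj) C D)

-- The pinpointing formula is a Horn encoding of classification, so it suffices to show, for
-- every B ⊆ T, that φ^all ∧ ⋀_{ax ∈ B} s_[ax] ∧ ¬ s_[C ⊑ D] is satisfiable iff B ⊭ C ⊑ D,
-- decidably; the theorem then follows by taking B = T' and B = T' minus one axiom.
-- If B ⊭ C ⊑ D: the rule instances over the signature of T are finitely many, so
-- saturating B and the trivial assertions terminates, and membership in the saturated set
-- is an assignment satisfying φ^all and the unit clauses of B which, by soundness of the
-- rules, selects only entailed assertions.
-- If B ⊨ C ⊑ D: an assignment satisfying φ^all and the unit clauses of B induces a
-- canonical model of B on the signature, with E ∈ A^I iff E ⊑ A and (E, F) ∈ r^I iff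
-- E ⊑ ∃r.F are derived and selected; the canonical element C satisfies C, hence D, so
-- s_[C ⊑ D] is selected. Only this element needs C in the signature; D may be arbitrary.
module Submission where

open import Defs
open import Data.List.Relation.Binary.Subset.Propositional using (_⊆_)
open import Data.Product using (_×_)
open import Function.Bundles using (_⇔_; mk⇔)

open import Data.Bool using (Bool)
open import Data.Empty using (⊥-elim)
open import Data.List
  using (List; []; _∷_; _++_; map; filter; length; concatMap; cartesianProductWith)
open import Data.List.Properties using (filter-notAll; ≡-dec)
open import Data.List.Membership.Propositional using (_∈_; _∉_; find; lose)
open import Data.List.Membership.Propositional.Properties
  using (∈-++⁺ˡ; ∈-++⁺ʳ; ∈-map⁺; ∈-map⁻; ∈-filter⁺; ∈-filter⁻; ∈-concatMap⁺; ∈-concatMap⁻;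
         ∈-cartesianProductWith⁺; ∈-cartesianProductWith⁻)
open import Data.List.Relation.Unary.All as All using (All; []; _∷_; all?)
open import Data.List.Relation.Unary.All.Properties using (++⁺; map⁺; concat⁺)
open import Data.List.Relation.Unary.Any as Any using (here; there; any?)
open import Data.Nat using (ℕ; suc; _<_; s≤s) renaming (_≟_ to _≟ℕ_)
open import Data.Nat.Properties using (≤-refl; <-≤-trans)
open import Data.Product using (Σ; ∃-syntax; _,_; proj₁; proj₂; uncurry)
open import Data.Sum using (_⊎_; inj₁; inj₂; [_,_])
open import Data.Unit using (⊤; tt)
open import Function using (_∘_; id)
open import Relation.Binary.Definitions using (DecidableEquality)
open import Relation.Binary.PropositionalEquality using (_≡_; _≢_; refl; cong; subst)
open import Relation.Nullary using (yes; no; ¬_; ¬?; does; contradiction)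
open import Relation.Nullary.Decidable using (map′; _×-dec_)
open import Relation.Unary using (Decidable)

module HornClosure {A : Set} (_≟_ : DecidableEquality A) where
  open import Data.List.Membership.DecPropositional _≟_ using (_∈?_)

  HornClause : Set
  HornClause = List A × A

  Fires : List A → HornClause → Set
  Fires S (ps , _) = All (_∈ S) ps

  fires? : ∀ S → Decidable (Fires S)
  fires? S (ps , _) = all? (_∈? S) ps

  -- Each round adds the conclusions of all clauses that fire and discards those clauses,
  -- so the number of remaining clauses bounds the number of rounds.
  private
    saturate : (n : ℕ) (cs : List HornClause) → length cs < n → List A → List A
    saturate (suc n) cs (s≤s bound) S with any? (fires? S) cs
    ... | no _  = S
    ... | yes f = saturate n (filter (¬? ∘ fires? S) cs)
                    (<-≤-trans (filter-notAll (¬? ∘ fires? S) cs (Any.map (λ p ¬p → ¬p p) f)) bound)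
                    (S ++ map proj₂ (filter (fires? S) cs))

    ⊆-saturate : ∀ n cs bound S {a} → a ∈ S → a ∈ saturate n cs bound S
    ⊆-saturate (suc n) cs (s≤s bound) S a∈S with any? (fires? S) cs
    ... | no _  = a∈S
    ... | yes _ = ⊆-saturate n _ _ _ (∈-++⁺ˡ a∈S)

    saturate-closed : ∀ n cs bound S {ps c} → (ps , c) ∈ cs →
                      All (_∈ saturate n cs bound S) ps → c ∈ saturate n cs bound S
    saturate-closed (suc n) cs (s≤s bound) S {ps} {c} cl∈cs prems with any? (fires? S) cs
    ... | no none = contradiction (Any.map (λ { refl → prems }) cl∈cs) none
    ... | yes _ with fires? S (ps , c)
    ...   | yes fires =
      ⊆-saturate n _ _ _ (∈-++⁺ʳ S (∈-map⁺ proj₂ (∈-filter⁺ (fires? S) cl∈cs fires)))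
    ...   | no ¬fires = saturate-closed n _ _ _ (∈-filter⁺ (¬? ∘ fires? S) cl∈cs ¬fires) prems

    All-saturate : ∀ {ℓ} (P : A → Set ℓ) n cs bound S →
                   (∀ {ps c} → (ps , c) ∈ cs → All P ps → P c) →
                   All P S → All P (saturate n cs bound S)
    All-saturate P (suc n) cs (s≤s bound) S sound pS with any? (fires? S) cs
    ... | no _  = pS
    ... | yes _ = All-saturate P n _ _ _ (λ m → sound (proj₁ (∈-filter⁻ (¬? ∘ fires? S) m)))
                    (++⁺ pS (map⁺ (All.tabulate λ m → fired (∈-filter⁻ (fires? S) m))))
      where
      fired : ∀ {ps c} → (ps , c) ∈ cs × Fires S (ps , c) → P c
      fired (cl∈cs , prems) = sound cl∈cs (All.map (All.lookup pS) prems)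

  closure : List HornClause → List A → List A
  closure cs = saturate (suc (length cs)) cs ≤-refl

  ⊆-closure : ∀ cs {S a} → a ∈ S → a ∈ closure cs S
  ⊆-closure cs = ⊆-saturate _ cs ≤-refl _

  closure-closed : ∀ {cs S ps c} → (ps , c) ∈ cs → All (_∈ closure cs S) ps → c ∈ closure cs S
  closure-closed = saturate-closed _ _ ≤-refl _

  All-closure : ∀ {ℓ} (P : A → Set ℓ) {cs S} →
                (∀ {ps c} → (ps , c) ∈ cs → All P ps → P c) → All P S → All P (closure cs S)
  All-closure P = All-saturate P _ _ ≤-refl _

_≟ᴮ_ : DecidableEquality Bas
top  ≟ᴮ top  = yes refl
top  ≟ᴮ nm _ = no λ ()
nm _ ≟ᴮ top  = no λ ()
nm A ≟ᴮ nm B = map′ (cong nm) (λ { refl → refl }) (A ≟ℕ B)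

_≟ᴬ_ : DecidableEquality NAx
conj C Cs D ≟ᴬ conj C' Cs' D' =
  map′ (λ { (refl , refl , refl) → refl }) (λ { refl → refl , refl , refl })
       (C ≟ᴮ C' ×-dec ≡-dec _≟ᴮ_ Cs Cs' ×-dec D ≟ᴮ D')
exR C r D ≟ᴬ exR C' r' D' =
  map′ (λ { (refl , refl , refl) → refl }) (λ { refl → refl , refl , refl })
       (C ≟ᴮ C' ×-dec r ≟ℕ r' ×-dec D ≟ᴮ D')
exL r C D ≟ᴬ exL r' C' D' =
  map′ (λ { (refl , refl , refl) → refl }) (λ { refl → refl , refl , refl })
       (r ≟ℕ r' ×-dec C ≟ᴮ C' ×-dec D ≟ᴮ D')
ri r rs s ≟ᴬ ri r' rs' s' =
  map′ (λ { (refl , refl , refl) → refl }) (λ { refl → refl , refl , refl })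
       (r ≟ℕ r' ×-dec ≡-dec _≟ℕ_ rs rs' ×-dec s ≟ℕ s')
conj _ _ _ ≟ᴬ exR _ _ _  = no λ ()
conj _ _ _ ≟ᴬ exL _ _ _  = no λ ()
conj _ _ _ ≟ᴬ ri _ _ _   = no λ ()
exR _ _ _  ≟ᴬ conj _ _ _ = no λ ()
exR _ _ _  ≟ᴬ exL _ _ _  = no λ ()
exR _ _ _  ≟ᴬ ri _ _ _   = no λ ()
exL _ _ _  ≟ᴬ conj _ _ _ = no λ ()
exL _ _ _  ≟ᴬ exR _ _ _  = no λ ()
exL _ _ _  ≟ᴬ ri _ _ _   = no λ ()
ri _ _ _   ≟ᴬ conj _ _ _ = no λ ()
ri _ _ _   ≟ᴬ exR _ _ _  = no λ ()
ri _ _ _   ≟ᴬ exL _ _ _  = no λ ()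

_⊨_ : TBox → NAx → Set₁
B ⊨ a = ∀ (I : Interp) → Model I B → SatAx I a

module _ (I : Interp) where
  open Interp I

  mapSub-sound : ∀ C Es x → All (SatAx I) (mapSub C Es) → ⟦ I ⟧ C x → All (λ E → ⟦ I ⟧ E x) Es
  mapSub-sound C []       x []         Cx = []
  mapSub-sound C (E ∷ Es) x (C⊑E ∷ ax) Cx = C⊑E x Cx [] ∷ mapSub-sound C Es x ax Cx

  chainPrems-sound : ∀ C xs → All (SatAx I) (chainPrems C xs) → ∀ x → ⟦ I ⟧ C x →
                     ∃[ y ] (Chain I (roles xs) x y × ⟦ I ⟧ (chainEnd C xs) y)
  chainPrems-sound C []             []           x Cx = x , refl , Cx
  chainPrems-sound C ((r , E) ∷ xs) (C⊑∃rE ∷ ax) x Cx =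
    let z , xrz , Ez     = C⊑∃rE x Cx
        y , zchy , endy  = chainPrems-sound E xs ax z Ez
    in  y , (z , xrz , zchy) , endy

  RuleApp-sound : ∀ {T ps c} → RuleApp T ps c → All (SatAx I) ps → SatAx I c
  RuleApp-sound (r1 C C₁ Cs D _) (ax ∷ C⊑C₁ ∷ C⊑Cs) x Cx [] =
    ax x (C⊑C₁ x Cx []) (mapSub-sound C Cs x C⊑Cs Cx)
  RuleApp-sound (r2 C C' r D _) (C⊑C' ∷ ax ∷ []) x Cx = ax x (C⊑C' x Cx [])
  RuleApp-sound (r3 C r E C' D _) (C⊑∃rE ∷ E⊑C' ∷ ax ∷ []) x Cx [] =
    let y , xry , Ey = C⊑∃rE x Cx in ax x y xry (E⊑C' y Ey [])
  RuleApp-sound (r4 C₀ r rs s xs _ roles≡) (ax ∷ chain) x C₀x =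
    let y , xchy , endy = chainPrems-sound C₀ xs chain x C₀x
    in  y , ax x y (subst (λ l → Chain I l x y) roles≡ xchy) , endy

module Instances (T : TBox) where

  occurrences : NAx → List Bas
  occurrences (conj C Cs D) = C ∷ Cs ++ D ∷ []
  occurrences (exR C r D)   = C ∷ D ∷ []
  occurrences (exL r C D)   = C ∷ D ∷ []
  occurrences (ri r rs s)   = []

  sig : List Bas
  sig = top ∷ concatMap occurrences T

  OccIn⇒∈occurrences : ∀ {E} ax → OccIn E ax → E ∈ occurrences ax
  OccIn⇒∈occurrences (conj C Cs D) (inj₁ refl)        = here refl
  OccIn⇒∈occurrences (conj C Cs D) (inj₂ (inj₁ E∈Cs)) = there (∈-++⁺ˡ E∈Cs)
  OccIn⇒∈occurrences (conj C Cs D) (inj₂ (inj₂ refl)) = there (∈-++⁺ʳ Cs (here refl))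
  OccIn⇒∈occurrences (exR C r D)   (inj₁ refl)        = here refl
  OccIn⇒∈occurrences (exR C r D)   (inj₂ refl)        = there (here refl)
  OccIn⇒∈occurrences (exL r C D)   (inj₁ refl)        = here refl
  OccIn⇒∈occurrences (exL r C D)   (inj₂ refl)        = there (here refl)

  occurs⇒∈sig : ∀ {E ax} → ax ∈ T → OccIn E ax → E ∈ sig
  occurs⇒∈sig ax∈T occ = there (∈-concatMap⁺ occurrences (lose ax∈T (OccIn⇒∈occurrences _ occ)))

  InSig⇒∈sig : ∀ {E} → InSig T E → E ∈ sig
  InSig⇒∈sig (inj₁ refl)              = here refl
  InSig⇒∈sig (inj₂ (_ , ax∈T , occ)) = occurs⇒∈sig ax∈T occ

  -- Constrains exactly the positions over which rule instances are enumerated.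
  OverSig : NAx → Set
  OverSig (conj C _ _) = C ∈ sig
  OverSig (exR C _ D)  = C ∈ sig × D ∈ sig
  OverSig _            = ⊤

  axiom-overSig : ∀ {ax} → ax ∈ T → OverSig ax
  axiom-overSig {conj C Cs D} ax∈T = occurs⇒∈sig ax∈T (inj₁ refl)
  axiom-overSig {exR C r D}   ax∈T = occurs⇒∈sig ax∈T (inj₁ refl) , occurs⇒∈sig ax∈T (inj₂ refl)
  axiom-overSig {exL r C D}   _    = tt
  axiom-overSig {ri r rs s}   _    = tt

  chainEnd-∈sig : ∀ {C} xs → C ∈ sig → All OverSig (chainPrems C xs) → chainEnd C xs ∈ sig
  chainEnd-∈sig []       C∈sig []                  = C∈sig
  chainEnd-∈sig (_ ∷ xs) _     ((_ , E∈sig) ∷ ovs) = chainEnd-∈sig xs E∈sig ovs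

  RuleApp-overSig : ∀ {ps c} → RuleApp T ps c → All OverSig ps → OverSig c
  RuleApp-overSig (r1 _ _ _ _ _)   (_ ∷ C∈sig ∷ _)                 = C∈sig
  RuleApp-overSig (r2 _ _ _ _ _)   (C∈sig ∷ (_ , D∈sig) ∷ [])      = C∈sig , D∈sig
  RuleApp-overSig (r3 _ _ _ _ _ _) ((C∈sig , _) ∷ _)               = C∈sig
  RuleApp-overSig (r4 _ _ _ _ [] _ ())
  RuleApp-overSig (r4 _ _ _ _ (_ ∷ xs) _ _) (_ ∷ (C₀∈sig , E∈sig) ∷ ovs) =
    C₀∈sig , chainEnd-∈sig xs E∈sig ovs

  chains : List RName → List (List (RName × Bas))
  chains []       = [] ∷ []
  chains (r ∷ rs) = cartesianProductWith (λ E xs → (r , E) ∷ xs) sig (chains rs)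

  chains-roles : ∀ rs {xs} → xs ∈ chains rs → roles xs ≡ rs
  chains-roles []       (here refl) = refl
  chains-roles (r ∷ rs) xs∈
    with _ , _ , _ , ys∈ , refl ← ∈-cartesianProductWith⁻ _ sig (chains rs) xs∈
    = cong (r ∷_) (chains-roles rs ys∈)

  ∈chains : ∀ {C} xs → All OverSig (chainPrems C xs) → xs ∈ chains (roles xs)
  ∈chains []             []                = here refl
  ∈chains ((r , E) ∷ xs) ((_ , E∈sig) ∷ ovs) =
    ∈-cartesianProductWith⁺ (λ E xs → (r , E) ∷ xs) E∈sig (∈chains xs ovs)

  instancesOf : NAx → List (List NAx × NAx)
  instancesOf (conj C₁ Cs D) = map (λ C → conj C₁ Cs D ∷ sub C C₁ ∷ mapSub C Cs , sub C D) sig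
  instancesOf (exR C' r D)   = map (λ C → sub C C' ∷ exR C' r D ∷ [] , exR C r D) sig
  instancesOf (exL r C' D)   =
    cartesianProductWith (λ C E → exR C r E ∷ sub E C' ∷ exL r C' D ∷ [] , sub C D) sig sig
  instancesOf (ri r rs s)    =
    cartesianProductWith (λ C₀ xs → ri r rs s ∷ chainPrems C₀ xs , exR C₀ s (chainEnd C₀ xs))
                         sig (chains (r ∷ rs))

  instances : List (List NAx × NAx)
  instances = concatMap instancesOf T

  instanceOf⇒RuleApp : ∀ {ps c} ax → ax ∈ T → (ps , c) ∈ instancesOf ax → RuleApp T ps c
  instanceOf⇒RuleApp (conj C₁ Cs D) ax∈T cl∈
    with C , _ , refl ← ∈-map⁻ _ cl∈ = r1 C C₁ Cs D ax∈T
  instanceOf⇒RuleApp (exR C' r D) ax∈T cl∈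
    with C , _ , refl ← ∈-map⁻ _ cl∈ = r2 C C' r D ax∈T
  instanceOf⇒RuleApp (exL r C' D) ax∈T cl∈
    with C , E , _ , _ , refl ← ∈-cartesianProductWith⁻ _ sig sig cl∈ = r3 C r E C' D ax∈T
  instanceOf⇒RuleApp (ri r rs s) ax∈T cl∈
    with C₀ , xs , _ , xs∈ , refl ← ∈-cartesianProductWith⁻ _ sig (chains (r ∷ rs)) cl∈ =
    r4 C₀ r rs s xs ax∈T (chains-roles (r ∷ rs) xs∈)

  instance⇒RuleApp : ∀ {ps c} → (ps , c) ∈ instances → RuleApp T ps c
  instance⇒RuleApp cl∈ with ax , ax∈T , cl∈ax ← find (∈-concatMap⁻ instancesOf cl∈) =
    instanceOf⇒RuleApp ax ax∈T cl∈ax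

  instancesOf⊆instances : ∀ {ax cl} → ax ∈ T → cl ∈ instancesOf ax → cl ∈ instances
  instancesOf⊆instances ax∈T cl∈ = ∈-concatMap⁺ instancesOf (lose ax∈T cl∈)

  RuleApp⇒instance : ∀ {ps c} → RuleApp T ps c → All OverSig ps → (ps , c) ∈ instances
  RuleApp⇒instance (r1 _ _ _ _ ax∈T) (_ ∷ C∈sig ∷ _) = instancesOf⊆instances ax∈T (∈-map⁺ _ C∈sig)
  RuleApp⇒instance (r2 _ _ _ _ ax∈T) (C∈sig ∷ _)     = instancesOf⊆instances ax∈T (∈-map⁺ _ C∈sig)
  RuleApp⇒instance (r3 _ _ _ _ _ ax∈T) ((C∈sig , E∈sig) ∷ _) =
    instancesOf⊆instances ax∈T (∈-cartesianProductWith⁺ _ C∈sig E∈sig)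
  RuleApp⇒instance (r4 _ _ _ _ [] _ ())
  RuleApp⇒instance (r4 _ _ _ _ xs@(_ ∷ _) ax∈T refl) (_ ∷ ovs@((C₀∈sig , _) ∷ _)) =
    instancesOf⊆instances ax∈T (∈-cartesianProductWith⁺ _ C₀∈sig (∈chains xs ovs))

  trivialsAt : Bas → List NAx
  trivialsAt C = sub C C ∷ sub C top ∷ []

  trivials : List NAx
  trivials = concatMap trivialsAt sig

  Trivial⇒∈trivials : ∀ {a} → Trivial T a → a ∈ trivials
  Trivial⇒∈trivials (_ , C∈ , inj₁ refl) =
    ∈-concatMap⁺ trivialsAt (lose (InSig⇒∈sig C∈) (here refl))
  Trivial⇒∈trivials (_ , C∈ , inj₂ refl) =
    ∈-concatMap⁺ trivialsAt (lose (InSig⇒∈sig C∈) (there (here refl)))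

  trivials-overSig : All OverSig trivials
  trivials-overSig =
    concat⁺ (map⁺ {xs = sig} {f = trivialsAt} (All.tabulate λ C∈sig → C∈sig ∷ C∈sig ∷ []))

  trivials-valid : ∀ I → All (SatAx I) trivials
  trivials-valid I =
    concat⁺ (map⁺ {xs = sig} {f = trivialsAt}
                  (All.tabulate λ _ → (λ _ Cx _ → Cx) ∷ (λ _ _ _ → tt) ∷ []))

module Saturation (T B : TBox) (B⊆T : B ⊆ T) where
  open Instances T
  open HornClosure _≟ᴬ_
  open import Data.List.Membership.DecPropositional _≟ᴬ_ using (_∈?_)

  saturated : List NAx
  saturated = closure instances (B ++ trivials)

  saturated-overSig : All OverSig saturated
  saturated-overSig = All-closure OverSig (RuleApp-overSig ∘ instance⇒RuleApp)
    (++⁺ (All.tabulate (axiom-overSig ∘ B⊆T)) trivials-overSig)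

  saturated-entailed : All (B ⊨_) saturated
  saturated-entailed = All-closure (B ⊨_) sound
    (++⁺ (All.tabulate λ a∈B I model → model _ a∈B)
         (All.tabulate λ a∈ I _ → All.lookup (trivials-valid I) a∈))
    where
    sound : ∀ {ps c} → (ps , c) ∈ instances → All (B ⊨_) ps → B ⊨ c
    sound cl∈ prems I model =
      RuleApp-sound I (instance⇒RuleApp cl∈) (All.map (λ p → p I model) prems)

  saturated-closed : ∀ {ps c} → RuleApp T ps c → All (_∈ saturated) ps → c ∈ saturated
  saturated-closed ra prems =
    closure-closed (RuleApp⇒instance ra (All.map (All.lookup saturated-overSig) prems)) prems

  assignment : NAx → Bool
  assignment a = does (a ∈? saturated)

  ∈saturated⇒selected : ∀ {a} → a ∈ saturated → Sel T assignment a
  ∈saturated⇒selected {a} a∈ with a ∈? saturated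
  ... | yes _ = inj₂ refl
  ... | no a∉ = contradiction a∈ a∉

  selected⇒∈saturated : ∀ {a} → Sel T assignment a → a ∈ saturated
  selected⇒∈saturated (inj₁ trivial) = ⊆-closure instances (∈-++⁺ʳ B (Trivial⇒∈trivials trivial))
  selected⇒∈saturated {a} (inj₂ true≡) with a ∈? saturated
  ... | yes a∈ = a∈

  assignment-satisfies : SatPhiAll T assignment
  assignment-satisfies _ _ (ra , _) sels =
    ∈saturated⇒selected (saturated-closed ra (All.map selected⇒∈saturated sels))

  entailed⊎satisfiable : (U : NAx → Set) → (∀ {ax} → U ax → ax ∈ B) → ∀ C D →
                         B ⊨ C ⊑ D ⊎ Satisfiable T U C D
  entailed⊎satisfiable U U⊆B C D with sub C D ∈? saturated
  ... | yes C⊑D∈ = inj₁ λ I model x Cx → All.lookup saturated-entailed C⊑D∈ I model x Cx []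
  ... | no C⊑D∉  = inj₂ (assignment , assignment-satisfies , units , C⊑D∉ ∘ selected⇒∈saturated)
    where
    units : ∀ ax → U ax → Sel T assignment ax
    units _ u = ∈saturated⇒selected (⊆-closure instances (∈-++⁺ˡ (U⊆B u)))

module CanonicalModel (T : TBox) (v : NAx → Bool) (v-satisfies : SatPhiAll T v)
                      (B : TBox) (B⊆T : B ⊆ T) (units : ∀ ax → ax ∈ B → Sel T v ax) where

  Marked : NAx → Set
  Marked a = Derived T a × Sel T v a

  marked-trivial : ∀ {a} → Trivial T a → Marked a
  marked-trivial t = triv t , inj₁ t

  marked-axiom : ∀ {ax} → ax ∈ B → Marked ax
  marked-axiom {ax} ax∈B = axm (B⊆T ax∈B) , units ax ax∈B

  marked-rule : ∀ {ps c} → RuleApp T ps c → All Marked ps → Marked c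
  marked-rule ra ms = rule ra derived , v-satisfies _ _ (ra , derived) (All.map proj₂ ms)
    where derived = All.map proj₁ ms

  model : Interp
  model = record { Δ    = Σ Bas (InSig T)
                 ; conc = λ A x → Marked (sub (proj₁ x) (nm A))
                 ; role = λ r x y → Marked (exR (proj₁ x) r (proj₁ y)) }

  open Interp model using (Δ)

  ⟦⟧⇒marked : ∀ E x → ⟦ model ⟧ E x → Marked (sub (proj₁ x) E)
  ⟦⟧⇒marked top    (C , C∈) _  = marked-trivial (C , C∈ , inj₂ refl)
  ⟦⟧⇒marked (nm A) _        Ax = Ax

  marked⇒⟦⟧ : ∀ E x → Marked (sub (proj₁ x) E) → ⟦ model ⟧ E x
  marked⇒⟦⟧ top    _ _  = tt
  marked⇒⟦⟧ (nm A) _ Ax = Ax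

  marked-mapSub : ∀ x Es → All (λ E → ⟦ model ⟧ E x) Es → All Marked (mapSub (proj₁ x) Es)
  marked-mapSub x []       []         = []
  marked-mapSub x (E ∷ Es) (Ex ∷ Esx) = ⟦⟧⇒marked E x Ex ∷ marked-mapSub x Es Esx

  Chain⇒marked : ∀ rs (x y : Δ) → Chain model rs x y →
                 ∃[ xs ] (roles xs ≡ rs × All Marked (chainPrems (proj₁ x) xs) ×
                          chainEnd (proj₁ x) xs ≡ proj₁ y)
  Chain⇒marked []       x y refl            = [] , refl , [] , refl
  Chain⇒marked (r ∷ rs) x y (z , xrz , zchy) =
    let xs , roles≡ , ms , end≡ = Chain⇒marked rs z y zchy
    in  (r , proj₁ z) ∷ xs , cong (r ∷_) roles≡ , xrz ∷ ms , end≡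

  model-satisfies : Model model B
  model-satisfies (conj C Cs D) ax∈B x Cx Csx =
    marked⇒⟦⟧ D x (marked-rule (r1 _ C Cs D (B⊆T ax∈B))
                     (marked-axiom ax∈B ∷ ⟦⟧⇒marked C x Cx ∷ marked-mapSub x Cs Csx))
  model-satisfies (exR C r D) ax∈B x Cx =
    (D , D∈) , marked-rule (r2 _ C r D (B⊆T ax∈B)) (⟦⟧⇒marked C x Cx ∷ marked-axiom ax∈B ∷ []) ,
    marked⇒⟦⟧ D (D , D∈) (marked-trivial (D , D∈ , inj₁ refl))
    where D∈ = inj₂ (_ , B⊆T ax∈B , inj₂ refl)
  model-satisfies (exL r C D) ax∈B x y xry Cy =
    marked⇒⟦⟧ D x (marked-rule (r3 _ r _ C D (B⊆T ax∈B))
                     (xry ∷ ⟦⟧⇒marked C y Cy ∷ marked-axiom ax∈B ∷ []))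
  model-satisfies (ri r rs s) ax∈B x y xchy
    with xs , roles≡ , ms , refl ← Chain⇒marked (r ∷ rs) x y xchy =
    marked-rule (r4 _ r rs s xs (B⊆T ax∈B) roles≡) (marked-axiom ax∈B ∷ ms)

  entailed⇒selected : ∀ {C D} → InSig T C → B ⊨ C ⊑ D → Sel T v (sub C D)
  entailed⇒selected {C} {D} C∈ C⊑D =
    proj₂ (⟦⟧⇒marked D (C , C∈) (C⊑D model model-satisfies (C , C∈)
                                    (marked⇒⟦⟧ C (C , C∈) (marked-trivial (C , C∈ , inj₁ refl)))))

_∖_ : TBox → NAx → TBox
B ∖ ax = filter (¬? ∘ (_≟ᴬ ax)) B

∖-⊆ : ∀ {B ax} → B ∖ ax ⊆ B
∖-⊆ {B} = proj₁ ∘ ∈-filter⁻ _ {xs = B}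

∈-∖⁺ : ∀ {B ax ax'} → ax' ∈ B → ax' ≢ ax → ax' ∈ B ∖ ax
∈-∖⁺ = ∈-filter⁺ _

∉-∖ : ∀ B {ax} → ax ∉ B ∖ ax
∉-∖ B ax∈ = proj₂ (∈-filter⁻ _ {xs = B} ax∈) refl

open Saturation using (entailed⊎satisfiable)

satisfiable⇒¬entailed : ∀ {T B U C D} → B ⊆ T → (∀ {ax} → ax ∈ B → U ax) → InSig T C →
                        Satisfiable T U C D → ¬ (B ⊨ C ⊑ D)
satisfiable⇒¬entailed B⊆T B⊆U C∈ (v , v-satisfies , units , ¬C⊑D) C⊑D =
  ¬C⊑D (CanonicalModel.entailed⇒selected _ v v-satisfies _ B⊆T (λ ax → units ax ∘ B⊆U) C∈ C⊑D)

theorem4 : (T T' : TBox) → T' ⊆ T → (C D : Bas) → InSig T C → InSig T D →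
           IsMinA T' C D ⇔ MinUnsat T T' C D
theorem4 T T' T'⊆T C D C∈ _ = mk⇔ minA⇒minUnsat minUnsat⇒minA
  where
  minA⇒minUnsat : IsMinA T' C D → MinUnsat T T' C D
  minA⇒minUnsat (C⊑D , minimal) = unsat , dropping
    where
    unsat : ¬ Satisfiable T (_∈ T') C D
    unsat sat = satisfiable⇒¬entailed T'⊆T id C∈ sat C⊑D

    dropping : ∀ axⱼ → axⱼ ∈ T' → Satisfiable T (λ ax → ax ∈ T' × ax ≢ axⱼ) C D
    dropping axⱼ axⱼ∈ =
      [ (λ C⊑D' → ⊥-elim (minimal (T' ∖ axⱼ) ∖-⊆ (axⱼ , axⱼ∈ , ∉-∖ T') C⊑D')) , id ]
      (entailed⊎satisfiable T (T' ∖ axⱼ) (T'⊆T ∘ ∖-⊆) _ (uncurry ∈-∖⁺) C D)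

  minUnsat⇒minA : MinUnsat T T' C D → IsMinA T' C D
  minUnsat⇒minA (unsat , dropping) = C⊑D , minimal
    where
    C⊑D : T' ⊨ C ⊑ D
    C⊑D = [ id , ⊥-elim ∘ unsat ] (entailed⊎satisfiable T T' T'⊆T _ id C D)

    minimal : ∀ T'' → T'' ⊆ T' → ∃[ ax ] (ax ∈ T' × ax ∉ T'') → ¬ (T'' ⊨ C ⊑ D)
    minimal T'' T''⊆T' (axⱼ , axⱼ∈ , axⱼ∉) =
      satisfiable⇒¬entailed (T'⊆T ∘ T''⊆T') (λ ax∈ → T''⊆T' ax∈ , λ { refl → axⱼ∉ ax∈ }) C∈
                            (dropping axⱼ axⱼ∈)
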